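{- Let $D$ be a deck of order $n$, length $\ell$, with $c$ cards. If $\ell>\Delta_n=n^2-n+1$, then for every symbol $s$ there exists a symbol not aligned with $s$. In particular $c\binom{n}{2}<\binom{\ell}{2}$.
   Context: A deck consists of a finite set $S$ of symbols together with a finite collection $D$ of distinct cards, each card being a subset of $S$, satisfying: (D1) any two distinct cards have exactly one symbol in common; (D2) every symbol of $S$ lies on at least two cards; (D3) every card contains at least two symbols; (D4) all cards have the same cardinality $n$ (the order); (D5) $S$ is nonempty. $\ell=|S|$ is the length and $c=|D|$ the number of cards. Two symbols are aligned if some card contains both of them. -}

module Defs where

open import Data.Nat using (ℕ; _≤_; _<_)
open import Data.Fin using (Fin)
open import Data.Fin.Subset using (Subset; _∈_; _∩_; ∣_∣)
open import Data.Product using (Σ; ∃; _×_)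
open import Relation.Binary.PropositionalEquality using (_≡_; _≢_)
open import Relation.Nullary using (¬_)

record IsDeck (ℓ c n : ℕ) (card : Fin c → Subset ℓ) : Set where
  field
    distinct : ∀ i j → card i ≡ card j → i ≡ j
    D1 : ∀ i j → i ≢ j → ∣ card i ∩ card j ∣ ≡ 1
    D2 : ∀ (s : Fin ℓ) → ∃ λ i → ∃ λ j → i ≢ j × s ∈ card i × s ∈ card j
    D3 : ∀ i → 2 ≤ ∣ card i ∣
    D4 : ∀ i → ∣ card i ∣ ≡ n
    D5 : 0 < ℓ

Aligned : ∀ {ℓ c} → (Fin c → Subset ℓ) → Fin ℓ → Fin ℓ → Set
Aligned card s t = ∃ λ i → s ∈ card i × t ∈ card i

-- Fix a symbol s and a card K avoiding it. Every card through s meets K in exactly one symbol,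
-- and distinct cards through s meet K in distinct symbols (two symbols lie on at most one
-- card), so s lies on r ≤ n cards. These cover at most r (n - 1) ≤ n² - n symbols besides s,
-- fewer than the ℓ - 1 available. Both bounds are obtained by double counting the incidence
-- function of the deck. Counting incidences also gives c n ≤ ℓ n, and multiplying by
-- n - 1 < ℓ - 1 yields the binomial inequality.
module Submission where

open import Defs
open import Data.Nat using (ℕ; zero; suc; _+_; _*_; _∸_; _≤_; _<_; z≤n; s≤s)
open import Data.Nat.Properties hiding (_≟_)
open import Data.Nat.Combinatorics using (_C_; nC1≡n; nCk+nC[k+1]≡[n+1]C[k+1])
open import Algebra.Properties.Semiring.Sum +-*-semiring
  using (sum; sum-syntax; ∑-comm; sum-remove; sum-cong-≗; *-distribˡ-sum; *-distribʳ-sum)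
open import Algebra.Properties.CommutativeSemigroup *-commutativeSemigroup using (x∙yz≈y∙xz)
open import Data.Bool using (true; false; if_then_else_)
open import Data.Fin using (Fin; zero; suc; punchIn; _≟_)
open import Data.Fin.Properties using (punchInᵢ≢i)
open import Data.Fin.Subset using (Subset; _∈_; _∉_; _∩_; ∣_∣)
open import Data.Fin.Subset.Properties using (_∈?_; x∈p∩q⁺)
open import Data.Vec using ([]; _∷_; lookup)
open import Data.Vec.Functional using (Vector; removeAt)
open import Data.Vec.Properties using ([]=⇒lookup; lookup⇒[]=)
open import Data.Product using (∃; _×_; _,_)
open import Function using (_∘_)
open import Relation.Binary.PropositionalEquality
open import Relation.Nullary using (¬_; yes; no; contradiction)

sum-mono-≤ : ∀ {m} {f g : Vector ℕ m} → (∀ i → f i ≤ g i) → sum f ≤ sum g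
sum-mono-≤ {zero}  _   = z≤n
sum-mono-≤ {suc m} f≤g = +-mono-≤ (f≤g zero) (sum-mono-≤ (f≤g ∘ suc))

sum-const : ∀ m x → ∑[ i < m ] x ≡ m * x
sum-const zero    x = refl
sum-const (suc m) x = cong (x +_) (sum-const m x)

≤-sum : ∀ {m} (f : Vector ℕ m) i → f i ≤ sum f
≤-sum f zero    = m≤m+n _ _
≤-sum f (suc i) = ≤-trans (≤-sum (f ∘ suc) i) (m≤n+m _ _)

+-≤-sum : ∀ {m} (f : Vector ℕ m) {i j} → i ≢ j → f i + f j ≤ sum f
+-≤-sum f {zero}  {zero}  0≢0 = contradiction refl 0≢0
+-≤-sum f {zero}  {suc j} _   = +-monoʳ-≤ (f zero) (≤-sum (f ∘ suc) j)
+-≤-sum f {suc i} {zero}  _   =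
  subst (_≤ sum f) (+-comm (f zero) _) (+-monoʳ-≤ (f zero) (≤-sum (f ∘ suc) i))
+-≤-sum f {suc i} {suc j} i≢j = ≤-trans (+-≤-sum (f ∘ suc) (i≢j ∘ cong suc)) (m≤n+m _ _)

sum<sum⇒∃< : ∀ {m} (f g : Vector ℕ m) → sum f < sum g → ∃ λ i → f i < g i
sum<sum⇒∃< {suc m} f g ∑f<∑g with f zero <? g zero
... | yes f₀<g₀ = zero , f₀<g₀
... | no  f₀≮g₀ with sum<sum⇒∃< (f ∘ suc) (g ∘ suc) tail<tail
  where
  tail<tail : sum (f ∘ suc) < sum (g ∘ suc)
  tail<tail = +-cancelˡ-< (g zero) _ _ (≤-<-trans (+-monoˡ-≤ _ (≮⇒≥ f₀≮g₀)) ∑f<∑g)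
...   | i , fᵢ<gᵢ = suc i , fᵢ<gᵢ

0<sum⇒∃0< : ∀ {m} (f : Vector ℕ m) → 0 < sum f → ∃ λ i → 0 < f i
0<sum⇒∃0< {m} f 0<∑f = sum<sum⇒∃< (λ _ → 0) f (subst (_< sum f) ∑0≡0 0<∑f)
  where
  ∑0≡0 : 0 ≡ ∑[ i < m ] 0
  ∑0≡0 = sym (trans (sum-const m 0) (*-zeroʳ m))

sum<length⇒∃0 : ∀ {m} (f : Vector ℕ m) → sum f < m → ∃ λ i → f i ≡ 0
sum<length⇒∃0 {m} f ∑f<m with sum<sum⇒∃< f (λ _ → 1) (subst (sum f <_) ∑1≡m ∑f<m)
  where
  ∑1≡m : m ≡ ∑[ i < m ] 1
  ∑1≡m = sym (trans (sum-const m 1) (*-identityʳ m))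
... | i , fᵢ<1 = i , n<1⇒n≡0 fᵢ<1

term<sum⇒∃0<other : ∀ {m} (f : Vector ℕ (suc m)) i → f i < sum f → ∃ λ j → j ≢ i × 0 < f j
term<sum⇒∃0<other f i fᵢ<∑f with 0<sum⇒∃0< (removeAt f i) 0<rest
  where
  0<rest : 0 < sum (removeAt f i)
  0<rest = +-cancelˡ-< (f i) 0 _
    (subst₂ _<_ (sym (+-identityʳ (f i))) (sum-remove {i = i} f) fᵢ<∑f)
... | j , 0<fⱼ = punchIn i j , punchInᵢ≢i i j , 0<fⱼ

sum≤1 : ∀ {m} (f : Vector ℕ m) → (∀ i → f i ≤ 1) →
        (∀ {i j} → 0 < f i → 0 < f j → i ≡ j) → sum f ≤ 1
sum≤1 {zero}  f _   _      = z≤n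
sum≤1 {suc m} f f≤1 unique with sum f ≤? 1
... | yes ∑f≤1 = ∑f≤1
... | no  ∑f≰1 with 0<sum⇒∃0< f (≤-trans (s≤s z≤n) (≰⇒> ∑f≰1))
...   | i , 0<fᵢ with term<sum⇒∃0<other f i (≤-<-trans (f≤1 i) (≰⇒> ∑f≰1))
...     | j , j≢i , 0<fⱼ = contradiction (unique 0<fⱼ 0<fᵢ) j≢i

χ : ∀ {m} → Subset m → Vector ℕ m
χ p x = if lookup p x then 1 else 0

∣p∣≡∑χ : ∀ {m} (p : Subset m) → ∣ p ∣ ≡ sum (χ p)
∣p∣≡∑χ []          = refl
∣p∣≡∑χ (true ∷ p)  = cong suc (∣p∣≡∑χ p)
∣p∣≡∑χ (false ∷ p) = ∣p∣≡∑χ p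

χ-∩ : ∀ {m} (p q : Subset m) x → χ (p ∩ q) x ≡ χ p x * χ q x
χ-∩ (true  ∷ p) (true  ∷ q) zero    = refl
χ-∩ (true  ∷ p) (false ∷ q) zero    = refl
χ-∩ (false ∷ p) (b     ∷ q) zero    = refl
χ-∩ (_     ∷ p) (_     ∷ q) (suc x) = χ-∩ p q x

χ≤1 : ∀ {m} (p : Subset m) x → χ p x ≤ 1
χ≤1 p x with lookup p x
... | true  = ≤-refl
... | false = z≤n

χ-idem : ∀ {m} (p : Subset m) x → χ p x * χ p x ≡ χ p x
χ-idem p x with lookup p x
... | true  = refl
... | false = refl

χ-∈ : ∀ {m} {p : Subset m} {x} → x ∈ p → χ p x ≡ 1
χ-∈ x∈p rewrite []=⇒lookup x∈p = refl

χ-∉ : ∀ {m} {p : Subset m} {x} → x ∉ p → χ p x ≡ 0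
χ-∉ {p = p} {x} x∉p with lookup p x in eq
... | true  = contradiction (lookup⇒[]= x p eq) x∉p
... | false = refl

0<χ⇒∈ : ∀ {m} (p : Subset m) x → 0 < χ p x → x ∈ p
0<χ⇒∈ p x 0<χ with lookup p x in eq
... | true = lookup⇒[]= x p eq

0<χ*χ⇒∈×∈ : ∀ {m k} (p : Subset m) (q : Subset k) x y → 0 < χ p x * χ q y → x ∈ p × y ∈ q
0<χ*χ⇒∈×∈ p q x y 0<χχ with lookup p x in eqp | lookup q y in eqq
... | true | true = lookup⇒[]= x p eqp , lookup⇒[]= y q eqq

χ*χ≤1 : ∀ {m k} (p : Subset m) (q : Subset k) x y → χ p x * χ q y ≤ 1
χ*χ≤1 p q x y = *-mono-≤ (χ≤1 p x) (χ≤1 q y)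

∈×∈⇒2≤∣p∣ : ∀ {m} {p : Subset m} {x y} → x ∈ p → y ∈ p → x ≢ y → 2 ≤ ∣ p ∣
∈×∈⇒2≤∣p∣ {p = p} x∈p y∈p x≢y = subst₂ _≤_ (cong₂ _+_ (χ-∈ x∈p) (χ-∈ y∈p)) (sym (∣p∣≡∑χ p))
  (+-≤-sum (χ p) x≢y)

2≤∣p∣⇒∃∈≢ : ∀ {m} (p : Subset m) → 2 ≤ ∣ p ∣ → ∀ x → ∃ λ y → y ∈ p × y ≢ x
2≤∣p∣⇒∃∈≢ {suc m} p 2≤∣p∣ x with term<sum⇒∃0<other (χ p) x χₓ<∑χ
  where
  χₓ<∑χ : χ p x < sum (χ p)
  χₓ<∑χ = ≤-<-trans (χ≤1 p x) (≤-trans 2≤∣p∣ (≤-reflexive (∣p∣≡∑χ p)))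
... | y , y≢x , 0<χy = y , 0<χ⇒∈ p y 0<χy , y≢x

excess-bound : ∀ {n r x} → r + x ≡ n * r → r ≤ n → x ≤ n * (n ∸ 1)
excess-bound {n} {r} {x} r+x≡nr r≤n = begin
  x                 ≡⟨ m+n∸m≡n r x ⟨
  r + x ∸ r         ≡⟨ cong₂ _∸_ r+x≡nr (sym (*-identityˡ r)) ⟩
  n * r ∸ 1 * r     ≡⟨ *-distribʳ-∸ r n 1 ⟨
  (n ∸ 1) * r       ≤⟨ *-monoʳ-≤ (n ∸ 1) r≤n ⟩
  (n ∸ 1) * n       ≡⟨ *-comm (n ∸ 1) n ⟩
  n * (n ∸ 1)       ∎
  where open ≤-Reasoning

n[n∸1]<ℓ∸1 : ∀ n {ℓ} → n * n ∸ n + 1 < ℓ → n * (n ∸ 1) < ℓ ∸ 1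
n[n∸1]<ℓ∸1 n {suc ℓ} bound = begin-strict
  n * (n ∸ 1)       ≡⟨ *-distribˡ-∸ n n 1 ⟩
  n * n ∸ n * 1     ≡⟨ cong (n * n ∸_) (*-identityʳ n) ⟩
  n * n ∸ n         <⟨ subst (_≤ ℓ) (+-comm (n * n ∸ n) 1) (≤-pred bound) ⟩
  ℓ                 ∎
  where open ≤-Reasoning

2*[nC2]≡n*[n∸1] : ∀ n → 2 * (n C 2) ≡ n * (n ∸ 1)
2*[nC2]≡n*[n∸1] zero          = refl
2*[nC2]≡n*[n∸1] (suc zero)    = refl
2*[nC2]≡n*[n∸1] (suc (suc k)) = begin
  2 * (suc (suc k) C 2)         ≡⟨ cong (2 *_) (nCk+nC[k+1]≡[n+1]C[k+1] (suc k) 1) ⟨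
  2 * (suc k C 1 + suc k C 2)   ≡⟨ cong (λ x → 2 * (x + suc k C 2)) (nC1≡n (suc k)) ⟩
  2 * (suc k + suc k C 2)       ≡⟨ *-distribˡ-+ 2 (suc k) _ ⟩
  2 * suc k + 2 * (suc k C 2)   ≡⟨ cong (2 * suc k +_) (2*[nC2]≡n*[n∸1] (suc k)) ⟩
  2 * suc k + suc k * k         ≡⟨ cong (_+ suc k * k) (*-comm 2 (suc k)) ⟩
  suc k * 2 + suc k * k         ≡⟨ *-distribˡ-+ (suc k) 2 k ⟨
  suc k * suc (suc k)           ≡⟨ *-comm (suc k) (suc (suc k)) ⟩
  suc (suc k) * suc k           ∎
  where open ≡-Reasoning

binomial-bound : ∀ {c n ℓ} → c * n ≤ ℓ * n → n * (n ∸ 1) < ℓ ∸ 1 → c * (n C 2) < ℓ C 2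
binomial-bound {c} {n} {suc ℓ} cn≤ℓn n[n∸1]<ℓ = *-cancelˡ-< 2 _ _ (begin-strict
  2 * (c * (n C 2))         ≡⟨ x∙yz≈y∙xz 2 c (n C 2) ⟩
  c * (2 * (n C 2))         ≡⟨ cong (c *_) (2*[nC2]≡n*[n∸1] n) ⟩
  c * (n * (n ∸ 1))         ≡⟨ *-assoc c n (n ∸ 1) ⟨
  c * n * (n ∸ 1)           ≤⟨ *-monoˡ-≤ (n ∸ 1) cn≤ℓn ⟩
  suc ℓ * n * (n ∸ 1)       ≡⟨ *-assoc (suc ℓ) n (n ∸ 1) ⟩
  suc ℓ * (n * (n ∸ 1))     <⟨ *-monoʳ-< (suc ℓ) n[n∸1]<ℓ ⟩
  suc ℓ * ℓ                 ≡⟨ 2*[nC2]≡n*[n∸1] (suc ℓ) ⟨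
  2 * (suc ℓ C 2)           ∎)
  where open ≤-Reasoning

module Deck {ℓ c n} {card : Fin c → Subset ℓ} (deck : IsDeck ℓ c n card) where
  open IsDeck deck

  meet : Fin c → Fin c → ℕ
  meet i j = ∑[ x < ℓ ] (χ (card i) x * χ (card j) x)

  cardsThrough : Fin ℓ → ℕ
  cardsThrough s = ∑[ i < c ] χ (card i) s

  cardsThroughBoth : Fin ℓ → Fin ℓ → ℕ
  cardsThroughBoth s t = ∑[ i < c ] (χ (card i) s * χ (card i) t)

  order≡∑χ : ∀ i → sum (χ (card i)) ≡ n
  order≡∑χ i = trans (sym (∣p∣≡∑χ (card i))) (D4 i)

  meet≡1 : ∀ {i j} → i ≢ j → meet i j ≡ 1
  meet≡1 {i} {j} i≢j = begin
    meet i j                            ≡⟨ sum-cong-≗ (χ-∩ (card i) (card j)) ⟨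
    sum (χ (card i ∩ card j))           ≡⟨ ∣p∣≡∑χ (card i ∩ card j) ⟨
    ∣ card i ∩ card j ∣                 ≡⟨ D1 i j i≢j ⟩
    1                                   ∎
    where open ≡-Reasoning

  card-unique : ∀ {s t i j} → s ≢ t → s ∈ card i → t ∈ card i → s ∈ card j → t ∈ card j → i ≡ j
  card-unique {s} {t} {i} {j} s≢t s∈i t∈i s∈j t∈j with i ≟ j
  ... | yes i≡j = i≡j
  ... | no  i≢j = contradiction (D1 i j i≢j) (>⇒≢ 1<∣i∩j∣)
    where
    1<∣i∩j∣ : 1 < ∣ card i ∩ card j ∣
    1<∣i∩j∣ = ∈×∈⇒2≤∣p∣ (x∈p∩q⁺ (s∈i , s∈j)) (x∈p∩q⁺ (t∈i , t∈j)) s≢t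

  cardsThroughBoth≤1 : ∀ {s t} → s ≢ t → cardsThroughBoth s t ≤ 1
  cardsThroughBoth≤1 {s} {t} s≢t = sum≤1 _ (λ i → χ*χ≤1 (card i) (card i) s t) unique
    where
    unique : ∀ {i j} → 0 < χ (card i) s * χ (card i) t → 0 < χ (card j) s * χ (card j) t → i ≡ j
    unique {i} {j} 0<i 0<j
      with 0<χ*χ⇒∈×∈ (card i) (card i) s t 0<i | 0<χ*χ⇒∈×∈ (card j) (card j) s t 0<j
    ... | s∈i , t∈i | s∈j , t∈j = card-unique s≢t s∈i t∈i s∈j t∈j

  -- Take t ≠ s on a card through s; of the two cards through t, at most one contains s.
  avoiding-card : ∀ s → ∃ λ k → s ∉ card k
  avoiding-card s with D2 s
  ... | i , _ , _ , s∈i , _ with 2≤∣p∣⇒∃∈≢ (card i) (D3 i) s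
  ...   | t , t∈i , t≢s with D2 t
  ...     | j , k , j≢k , t∈j , t∈k with s ∈? card j | s ∈? card k
  ...       | no s∉j | _      = j , s∉j
  ...       | yes _  | no s∉k = k , s∉k
  ...       | yes s∈j | yes s∈k =
    contradiction (card-unique (t≢s ∘ sym) s∈j t∈j s∈k t∈k) j≢k

  cardsThrough≤order : ∀ s → cardsThrough s ≤ n
  cardsThrough≤order s with avoiding-card s
  ... | K , s∉K = begin
    ∑[ i < c ] χ (card i) s                             ≡⟨ sum-cong-≗ through-meets-K ⟩
    ∑[ i < c ] (χ (card i) s * meet i K)                ≡⟨ sum-cong-≗ expand ⟩
    ∑[ i < c ] ∑[ x < ℓ ] triple i x                    ≡⟨ ∑-comm triple ⟩
    ∑[ x < ℓ ] ∑[ i < c ] triple i x                    ≡⟨ sum-cong-≗ collect ⟨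
    ∑[ x < ℓ ] (cardsThroughBoth s x * χ (card K) x)    ≤⟨ sum-mono-≤ at-most-once ⟩
    sum (χ (card K))                                    ≡⟨ order≡∑χ K ⟩
    n                                                   ∎
    where
    open ≤-Reasoning
    triple : Fin c → Fin ℓ → ℕ
    triple i x = χ (card i) s * χ (card i) x * χ (card K) x
    through-meets-K : ∀ i → χ (card i) s ≡ χ (card i) s * meet i K
    through-meets-K i with s ∈? card i
    ... | yes s∈i = sym (trans (cong (χ (card i) s *_) (meet≡1 λ { refl → s∉K s∈i }))
                               (*-identityʳ (χ (card i) s)))
    ... | no  s∉i rewrite χ-∉ s∉i = refl
    expand : ∀ i → χ (card i) s * meet i K ≡ ∑[ x < ℓ ] triple i x
    expand i = trans (*-distribˡ-sum (χ (card i) s) (λ x → χ (card i) x * χ (card K) x))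
                     (sum-cong-≗ λ x → sym (*-assoc (χ (card i) s) (χ (card i) x) (χ (card K) x)))
    collect : ∀ x → cardsThroughBoth s x * χ (card K) x ≡ ∑[ i < c ] triple i x
    collect x = *-distribʳ-sum (χ (card K) x) (λ i → χ (card i) s * χ (card i) x)
    at-most-once : ∀ x → cardsThroughBoth s x * χ (card K) x ≤ χ (card K) x
    at-most-once x with x ≟ s
    ... | yes refl rewrite χ-∉ s∉K = ≤-reflexive (*-zeroʳ (cardsThroughBoth s s))
    ... | no  x≢s  = ≤-trans (*-monoˡ-≤ (χ (card K) x) (cardsThroughBoth≤1 (x≢s ∘ sym)))
                                (≤-reflexive (*-identityˡ (χ (card K) x)))

  cardsThroughBoth-diag : ∀ s → cardsThroughBoth s s ≡ cardsThrough s
  cardsThroughBoth-diag s = sum-cong-≗ λ i → χ-idem (card i) s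

  ∑cardsThroughBoth : ∀ s → ∑[ t < ℓ ] cardsThroughBoth s t ≡ n * cardsThrough s
  ∑cardsThroughBoth s = begin
    ∑[ t < ℓ ] ∑[ i < c ] (χ (card i) s * χ (card i) t)
      ≡⟨ ∑-comm (λ i t → χ (card i) s * χ (card i) t) ⟨
    ∑[ i < c ] ∑[ t < ℓ ] (χ (card i) s * χ (card i) t)
      ≡⟨ sum-cong-≗ (λ i → *-distribˡ-sum (χ (card i) s) (χ (card i))) ⟨
    ∑[ i < c ] (χ (card i) s * sum (χ (card i)))
      ≡⟨ sum-cong-≗ (λ i → cong (χ (card i) s *_) (order≡∑χ i)) ⟩
    ∑[ i < c ] (χ (card i) s * n)
      ≡⟨ sum-cong-≗ (λ i → *-comm (χ (card i) s) n) ⟩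
    ∑[ i < c ] (n * χ (card i) s)
      ≡⟨ *-distribˡ-sum n (λ i → χ (card i) s) ⟨
    n * cardsThrough s
      ∎
    where open ≡-Reasoning

  ∑cardsThrough : ∑[ s < ℓ ] cardsThrough s ≡ c * n
  ∑cardsThrough = begin
    ∑[ s < ℓ ] ∑[ i < c ] χ (card i) s  ≡⟨ ∑-comm (λ i s → χ (card i) s) ⟨
    ∑[ i < c ] sum (χ (card i))         ≡⟨ sum-cong-≗ order≡∑χ ⟩
    ∑[ i < c ] n                        ≡⟨ sum-const c n ⟩
    c * n                               ∎
    where open ≡-Reasoning

  cards*order≤length*order : c * n ≤ ℓ * n
  cards*order≤length*order = begin
    c * n                       ≡⟨ ∑cardsThrough ⟨
    ∑[ s < ℓ ] cardsThrough s   ≤⟨ sum-mono-≤ cardsThrough≤order ⟩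
    ∑[ s < ℓ ] n                ≡⟨ sum-const ℓ n ⟩
    ℓ * n                       ∎
    where open ≤-Reasoning

  cardsThroughBoth≡0⇒¬Aligned : ∀ {s t} → cardsThroughBoth s t ≡ 0 → ¬ Aligned card s t
  cardsThroughBoth≡0⇒¬Aligned {s} {t} none (i , s∈i , t∈i) = contradiction none (>⇒≢ on-i)
    where
    on-i : 0 < cardsThroughBoth s t
    on-i = ≤-trans (≤-reflexive (sym (cong₂ _*_ (χ-∈ s∈i) (χ-∈ t∈i))))
                   (≤-sum (λ i → χ (card i) s * χ (card i) t) i)

-- The symbols t ≠ s are indexed by punchIn s; on them the counts of shared cards sum to
-- n r - r ≤ n (n - 1) < ℓ - 1, so one of them is zero.
unaligned-symbol : ∀ {ℓ c n} {card : Fin c → Subset ℓ} → IsDeck ℓ c n card →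
                   n * n ∸ n + 1 < ℓ → ∀ s → ∃ λ t → ¬ Aligned card s t
unaligned-symbol {suc ℓ} {n = n} deck bound s
  with sum<length⇒∃0 (removeAt (cardsThroughBoth s) s) others<ℓ
  where
  open Deck deck
  others<ℓ : sum (removeAt (cardsThroughBoth s) s) < ℓ
  others<ℓ = ≤-<-trans (excess-bound {n} {cardsThrough s} split (cardsThrough≤order s))
                       (n[n∸1]<ℓ∸1 n bound)
    where
    split : cardsThrough s + sum (removeAt (cardsThroughBoth s) s) ≡ n * cardsThrough s
    split = begin
      cardsThrough s + sum (removeAt (cardsThroughBoth s) s)
        ≡⟨ cong (_+ sum (removeAt (cardsThroughBoth s) s)) (cardsThroughBoth-diag s) ⟨
      cardsThroughBoth s s + sum (removeAt (cardsThroughBoth s) s)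
        ≡⟨ sum-remove (cardsThroughBoth s) ⟨
      ∑[ t < suc ℓ ] cardsThroughBoth s t
        ≡⟨ ∑cardsThroughBoth s ⟩
      n * cardsThrough s ∎
      where open ≡-Reasoning
... | j , none = punchIn s j , Deck.cardsThroughBoth≡0⇒¬Aligned deck none

mainTheorem7 : (ℓ c n : ℕ) (card : Fin c → Subset ℓ) → IsDeck ℓ c n card →
    n * n ∸ n + 1 < ℓ →
    (∀ (s : Fin ℓ) → ∃ λ t → ¬ Aligned card s t) × (c * (n C 2) < ℓ C 2)
mainTheorem7 ℓ c n card deck bound =
  unaligned-symbol deck bound ,
  binomial-bound {c} {n} {ℓ} (Deck.cards*order≤length*order deck) (n[n∸1]<ℓ∸1 n bound)
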